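{- For all positive integers $n,k$ with $n\ge k$, $$q_{n,k} = \mathrm{lcm}\{(n-m+1)\,q_{m-1,k-1} \;;\; k\le m\le n\}.$$
   Context: For natural numbers $n\ge k$, $$q_{n,k} = \mathrm{lcm}\{i_1 i_2\cdots i_k \mid i_1,\dots,i_k \text{ positive integers},\ i_1+\dots+i_k\le n\},$$ with the convention $q_{n,0}=1$ for all $n\in\mathbb{N}$. -}

module Defs where

open import Data.Nat using (ℕ; zero; suc; _+_; _*_; _∸_)
open import Data.Nat.LCM using (lcm)
open import Data.List using (List; []; _∷_; [_]; map; concatMap; foldr)
open import Data.Nat.ListAction using (product)

range : ℕ → ℕ → List ℕ
range a zero = []
range a (suc len) = a ∷ range (suc a) len

-- inclusive interval [a, b] (empty if b < a)
interval : ℕ → ℕ → List ℕ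
interval a b = range a (suc b ∸ a)

-- all k-tuples (i₁,…,i_k) of positive integers with i₁+…+i_k ≤ n
tuples : ℕ → ℕ → List (List ℕ)
tuples n zero = [ [] ]
tuples n (suc k) = concatMap (λ i → map (i ∷_) (tuples (n ∸ i) k)) (interval 1 n)

lcmList : List ℕ → ℕ
lcmList = foldr lcm 1

q : ℕ → ℕ → ℕ
q n k = lcmList (map product (tuples n k))

{-# OPTIONS --safe #-}
module Submission where

-- Split a tuple into its first entry i and the rest: the rest is a tuple of length k with sum at
-- most n − i, so q_{n,k+1} is the lcm of the numbers i · q_{n−i,k}, where the terms with
-- n − i < k do not occur because there are no such tuples. Substituting m = n − i + 1 gives the
-- formula.

open import Defs
open import Data.Nat using (ℕ; zero; suc; _≤_; _<_; _*_; _∸_; _+_; z≤n; s≤s; s≤s⁻¹; z<s; s<s⁻¹)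
open import Data.Nat.Properties
open import Data.Nat.Divisibility
open import Data.Nat.LCM using (m∣lcm[m,n]; n∣lcm[m,n]; lcm-least)
open import Data.List using (List; []; _∷_; map; replicate)
open import Data.List.Relation.Unary.Any using (here; there)
open import Data.List.Membership.Propositional using (_∈_; lose; find)
open import Data.List.Membership.Propositional.Properties using (∈-map⁺; ∈-map⁻; ∈-concatMap⁺; ∈-concatMap⁻)
open import Data.Nat.ListAction using (product)
open import Data.Product using (_×_; _,_; ∃₂)
open import Data.Sum using (inj₁; inj₂)
open import Relation.Binary.PropositionalEquality

∈⇒∣lcmList : ∀ {x xs} → x ∈ xs → x ∣ lcmList xs
∈⇒∣lcmList (here refl) = m∣lcm[m,n] _ _
∈⇒∣lcmList {xs = y ∷ ys} (there x∈ys) = ∣-trans (∈⇒∣lcmList x∈ys) (n∣lcm[m,n] y (lcmList ys))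

lcmList-least : ∀ {d} xs → (∀ {x} → x ∈ xs → x ∣ d) → lcmList xs ∣ d
lcmList-least [] _ = 1∣ _
lcmList-least (x ∷ xs) all∣d = lcm-least (all∣d (here refl)) (lcmList-least xs (λ x∈xs → all∣d (there x∈xs)))

lcmList-map-least : ∀ {A : Set} {d} (f : A → ℕ) xs → (∀ {a} → a ∈ xs → f a ∣ d) → lcmList (map f xs) ∣ d
lcmList-map-least {d = d} f xs f∣d = lcmList-least (map f xs) image∣d
  where
  image∣d : ∀ {y} → y ∈ map f xs → y ∣ d
  image∣d y∈ with ∈-map⁻ f y∈
  ... | a , a∈xs , refl = f∣d a∈xs

∈-range⁻ : ∀ {x} a len → x ∈ range a len → a ≤ x × x ∸ a < len
∈-range⁻ a (suc len) (here refl) = ≤-refl , subst (_< suc len) (sym (n∸n≡0 a)) z<s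
∈-range⁻ a (suc len) (there x∈) with ∈-range⁻ (suc a) len x∈
... | s≤s {n = x} a≤x , x∸a<len = m≤n⇒m≤1+n a≤x , subst (_< suc len) (sym (+-∸-assoc 1 a≤x)) (s≤s x∸a<len)

∈-range⁺ : ∀ {x} a len → a ≤ x → x ∸ a < len → x ∈ range a len
∈-range⁺ a (suc len) a≤x x∸a<len with m≤n⇒m<n∨m≡n a≤x
... | inj₂ refl = here refl
... | inj₁ (s≤s {n = x} a≤x) =
  there (∈-range⁺ (suc a) len (s≤s a≤x) (s<s⁻¹ (subst (_< suc len) (+-∸-assoc 1 a≤x) x∸a<len)))

∈-interval⁻ : ∀ {x} a b → x ∈ interval a b → a ≤ x × x ≤ b
∈-interval⁻ a b x∈ with ∈-range⁻ a (suc b ∸ a) x∈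
... | a≤x , x∸a<1+b∸a = a≤x , s≤s⁻¹ (≰⇒> (λ 1+b≤x → <⇒≱ x∸a<1+b∸a (∸-monoˡ-≤ a 1+b≤x)))

∈-interval⁺ : ∀ {x} a b → a ≤ x → x ≤ b → x ∈ interval a b
∈-interval⁺ a b a≤x x≤b = ∈-range⁺ a (suc b ∸ a) a≤x (∸-monoˡ-< (s≤s x≤b) a≤x)

∈-tuples-suc⁺ : ∀ {n k i t} → 1 ≤ i → i ≤ n → t ∈ tuples (n ∸ i) k → i ∷ t ∈ tuples n (suc k)
∈-tuples-suc⁺ {n} {k} {i} {t} 1≤i i≤n t∈ = ∈-concatMap⁺ (λ j → map (j ∷_) (tuples (n ∸ j) k))
  (lose {P = λ j → i ∷ t ∈ map (j ∷_) (tuples (n ∸ j) k)} (∈-interval⁺ 1 n 1≤i i≤n) (∈-map⁺ (i ∷_) t∈))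

∈-tuples-suc⁻ : ∀ {n k t} → t ∈ tuples n (suc k) →
  ∃₂ λ i t′ → t ≡ i ∷ t′ × 1 ≤ i × i ≤ n × t′ ∈ tuples (n ∸ i) k
∈-tuples-suc⁻ {n} {k} t∈ with find (∈-concatMap⁻ (λ i → map (i ∷_) (tuples (n ∸ i) k)) {xs = interval 1 n} t∈)
... | i , i∈ , t∈i∷ with ∈-map⁻ (i ∷_) t∈i∷ | ∈-interval⁻ 1 n i∈
... | t′ , t′∈ , refl | 1≤i , i≤n = i , t′ , refl , 1≤i , i≤n , t′∈

∈-tuples⇒≤ : ∀ {n k t} → t ∈ tuples n k → k ≤ n
∈-tuples⇒≤ {k = zero} _ = z≤n
∈-tuples⇒≤ {n} {k = suc k} t∈ with ∈-tuples-suc⁻ {n} {k} t∈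
... | i , _ , refl , 1≤i , i≤n , t′∈ = ≤-trans (s≤s (∈-tuples⇒≤ {n ∸ i} {k} t′∈)) (∸-monoʳ-< 1≤i i≤n)

replicate-1∈tuples : ∀ {n k} → k ≤ n → replicate k 1 ∈ tuples n k
replicate-1∈tuples {k = zero} _ = here refl
replicate-1∈tuples {suc n} {suc k} (s≤s k≤n) = ∈-tuples-suc⁺ {suc n} {k} (s≤s z≤n) (s≤s z≤n) (replicate-1∈tuples k≤n)

product∣q : ∀ {n k t} → t ∈ tuples n k → product t ∣ q n k
product∣q {n} {k} t∈ = ∈⇒∣lcmList (∈-map⁺ product t∈)

q-least : ∀ {n k d} → (∀ {t} → t ∈ tuples n k → product t ∣ d) → q n k ∣ d
q-least {n} {k} = lcmList-map-least product (tuples n k)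

i∣q[n,1+k] : ∀ {n k i} → 1 ≤ i → i ≤ n → k ≤ n ∸ i → i ∣ q n (suc k)
i∣q[n,1+k] {n} {k} 1≤i i≤n k≤n∸i =
  ∣-trans (m∣m*n _) (product∣q {n} {suc k} (∈-tuples-suc⁺ {n} {k} 1≤i i≤n (replicate-1∈tuples k≤n∸i)))

-- Dividing q_{n,k+1} by i, each product of a tuple in tuples (n ∸ i) k divides the quotient.
i*q[n∸i,k]∣q[n,1+k] : ∀ {n k i} → 1 ≤ i → i ≤ n → k ≤ n ∸ i → i * q (n ∸ i) k ∣ q n (suc k)
i*q[n∸i,k]∣q[n,1+k] {n} {k} {i@(suc _)} 1≤i i≤n k≤n∸i with i∣q[n,1+k] {n} {k} 1≤i i≤n k≤n∸i
... | divides e Q≡e*i = subst (i * q (n ∸ i) k ∣_) (sym Q≡i*e) (*-monoʳ-∣ i (q-least {n ∸ i} {k} product∣e))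
  where
  Q≡i*e : q n (suc k) ≡ i * e
  Q≡i*e = trans Q≡e*i (*-comm e i)
  product∣e : ∀ {t} → t ∈ tuples (n ∸ i) k → product t ∣ e
  product∣e t∈ = *-cancelˡ-∣ i (subst (i * _ ∣_) Q≡i*e (product∣q {n} {suc k} (∈-tuples-suc⁺ {n} {k} 1≤i i≤n t∈)))

m∸[1+n]+1≡m∸n : ∀ {m n} → n < m → m ∸ suc n + 1 ≡ m ∸ n
m∸[1+n]+1≡m∸n {suc m} {n} (s≤s n≤m) = trans (+-comm (m ∸ n) 1) (sym (+-∸-assoc 1 n≤m))

recurrenceTerms : ℕ → ℕ → List ℕ
recurrenceTerms n k = map (λ m → (n ∸ m + 1) * q (m ∸ 1) k) (interval (suc k) n)

recurrenceTerm∣q : ∀ {n k m} → suc k ≤ m → m ≤ n → (n ∸ m + 1) * q (m ∸ 1) k ∣ q n (suc k)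
recurrenceTerm∣q {n} {k} {suc m} (s≤s k≤m) m<n rewrite m∸[1+n]+1≡m∸n m<n =
  subst (λ x → (n ∸ m) * q x k ∣ q n (suc k)) n∸[n∸m]≡m
    (i*q[n∸i,k]∣q[n,1+k] (m<n⇒0<n∸m m<n) (m∸n≤m n m) (subst (k ≤_) (sym n∸[n∸m]≡m) k≤m))
  where
  n∸[n∸m]≡m : n ∸ (n ∸ m) ≡ m
  n∸[n∸m]≡m = m∸[m∸n]≡n (<⇒≤ m<n)

product∣lcmList-recurrenceTerms : ∀ {n k t} → t ∈ tuples n (suc k) → product t ∣ lcmList (recurrenceTerms n k)
product∣lcmList-recurrenceTerms {n} {k} t∈ with ∈-tuples-suc⁻ {n} {k} t∈
... | i , t′ , refl , 1≤i , i≤n , t′∈ =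
  ∣-trans (*-monoʳ-∣ i (product∣q {n ∸ i} {k} t′∈))
    (subst (λ c → c * q (n ∸ i) k ∣ lcmList (recurrenceTerms n k)) i-as-term
      (∈⇒∣lcmList (∈-map⁺ (λ m → (n ∸ m + 1) * q (m ∸ 1) k) m∈)))
  where
  n∸i<n : n ∸ i < n
  n∸i<n = ∸-monoʳ-< 1≤i i≤n
  i-as-term : n ∸ suc (n ∸ i) + 1 ≡ i
  i-as-term = trans (m∸[1+n]+1≡m∸n n∸i<n) (m∸[m∸n]≡n i≤n)
  m∈ : suc (n ∸ i) ∈ interval (suc k) n
  m∈ = ∈-interval⁺ (suc k) n (s≤s (∈-tuples⇒≤ {n ∸ i} {k} t′∈)) n∸i<n

proposition2 : (n k : ℕ) → 1 ≤ k → k ≤ n →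
    q n k ≡ lcmList (map (λ m → (n ∸ m + 1) * q (m ∸ 1) (k ∸ 1)) (interval k n))
proposition2 n (suc k) _ _ = ∣-antisym
  (q-least {n} {suc k} (product∣lcmList-recurrenceTerms {n} {k}))
  (lcmList-map-least _ (interval (suc k) n) λ m∈ →
    let k<m , m≤n = ∈-interval⁻ (suc k) n m∈ in recurrenceTerm∣q {n} {k} k<m m≤n)
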